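{- There exist constants $c>0$ and $\rho>0$ such that for arbitrarily large $n$ there are $n$-vertex graphs for which, with probability at least $\rho$ over the choice of random IDs, the longest directed path in the random lowest ID scheme has length at least $c\log n$.
   Context: Random lowest ID scheme: every vertex receives an independent uniformly random ID (distinct with probability 1), and each vertex $v$ chooses as its parent $p(v)$ the vertex with smallest random ID in its closed neighborhood $N(v)\cup\{v\}$ (possibly $v$ itself). The longest directed path from $v$ is obtained by following parent pointers from $v$ until a cycle (here a self loop) is reached; the longest directed path of the graph is the maximum over all starting vertices of its length. -}

module Defs where

open import Data.Nat using (ℕ; zero; suc; _<ᵇ_; _⊔_)
open import Data.Fin using (Fin; zero; suc; toℕ)
open import Data.Fin.Properties using (_≟_)
open import Data.Bool using (Bool; true; false; if_then_else_; _∧_; _∨_; not)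
open import Data.List using (List; []; _∷_; map; concatMap; foldr; filterᵇ; length)
open import Data.Bool.ListAction using (and)
open import Data.List.Base using (allFin)
open import Relation.Nullary.Decidable using (⌊_⌋)
open import Relation.Binary.PropositionalEquality using (_≡_)

record Graph (n : ℕ) : Set where
  field
    adj    : Fin n → Fin n → Bool
    sym    : ∀ u v → adj u v ≡ adj v u
    irrefl : ∀ v → adj v v ≡ false
open Graph public

_==_ : ∀ {n} → Fin n → Fin n → Bool
i == j = ⌊ i ≟ j ⌋

allFuns : (n m : ℕ) → List (Fin n → Fin m)
allFuns zero    m = (λ ()) ∷ []
allFuns (suc n) m =
  concatMap (λ f → map (λ i → λ { zero → i ; (suc k) → f k }) (allFin m)) (allFuns n m)

isInjective : ∀ {n m} → (Fin n → Fin m) → Bool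
isInjective {n} f =
  and (map (λ i → and (map (λ j → (i == j) ∨ not (f i == f j)) (allFin n))) (allFin n))

-- ID assignments: injective maps Fin n → Fin n (the relative order of n i.i.d.
-- uniform IDs is a uniformly random permutation; only the order matters).
idAssignments : (n : ℕ) → List (Fin n → Fin n)
idAssignments n = filterᵇ isInjective (allFuns n n)

parent : ∀ {n} → Graph n → (Fin n → Fin n) → Fin n → Fin n
parent {n} G σ v =
  foldr (λ u best → if ((u == v) ∨ adj G v u) ∧ (toℕ (σ u) <ᵇ toℕ (σ best))
                    then u else best)
        v (allFin n)

pathLenFuel : ∀ {n} → Graph n → (Fin n → Fin n) → ℕ → Fin n → ℕ
pathLenFuel G σ zero    v = 0
pathLenFuel G σ (suc k) v =
  if parent G σ v == v then 0 else suc (pathLenFuel G σ k (parent G σ v))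

-- Fuel n suffices: IDs strictly decrease along non-loop edges.
pathLen : ∀ {n} → Graph n → (Fin n → Fin n) → Fin n → ℕ
pathLen {n} G σ v = pathLenFuel G σ n v

longestPath : ∀ {n} → Graph n → (Fin n → Fin n) → ℕ
longestPath {n} G σ = foldr _⊔_ 0 (map (pathLen G σ) (allFin n))

-- On the cube Cube k = Vec Bool k, the level of x is the position of its first
-- true bit (0 for the zero vector), and vertices on consecutive levels are joined. An ID
-- ranking of the cube is ascending if, recursively, the minimum on the top half (leading
-- bit true, i.e. level k) lies below the minimum on the bottom half. Then the minima of
-- levels 0, 1, …, k are linked by parent pointers: a directed path of length k
-- (ladder-path). Every injective ranking becomes ascending once the positions are XOR-ed
-- with a suitable mask (mask-to-ascending).
--
-- G_k is the disjoint union of B = 2^k gadgets, so n = B * B = 4^k and k = (1/2) log₂ n.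
-- A mask choice e : Fin B → Fin B relabels every copy by a XOR mask. For each ID assignment
-- σ at most (B - 1)^B of the B^B mask choices leave no copy ascending (count-everywhere),
-- while for each mask choice σ ↦ σ ∘ masked e permutes the ID assignments (relabel-count).
-- Double counting (averaging) then gives Pr[longest path ≥ k] ≥ 1 - (1 - 1/B)^B ≥ 1/2
-- (half-from-average).

module Submission where

open import Defs hiding (sym)
open import Data.Nat using (ℕ; >-nonZero; zero; suc; _+_; _*_; _^_; _∸_; pred; _≤_; _<_; z≤n; s≤s; z<s; _⊔_; _⊓_; _<ᵇ_; _≤ᵇ_; _≡ᵇ_; _≤?_; _<?_; NonZero)
open import Data.Nat.Properties
open import Data.Nat.ListAction using (sum)
open import Data.Nat.Tactic.RingSolver using (solve-∀)
open import Algebra.Properties.CommutativeSemigroup +-commutativeSemigroup using () renaming (x∙yz≈y∙xz to x+[y+z]≡y+[x+z])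
open import Algebra.Properties.CommutativeSemigroup *-commutativeSemigroup using () renaming (x∙yz≈y∙xz to x*[y*z]≡y*[x*z])
open import Data.Fin using (Fin; zero; suc; toℕ; combine; quotient; remainder)
open import Data.Fin.Properties using (toℕ-injective; injective⇒≤; remQuot-combine; combine-remQuot) renaming (_≟_ to _≟ᶠ_)
open import Data.Bool using (Bool; true; false; T; _∧_; _∨_; not; _xor_; if_then_else_)
open import Data.Bool.Properties using (T-∧; T-∨; ∨-comm; ∧-zeroʳ; xor-assoc; xor-same; xor-identityʳ)
open import Data.Bool.ListAction using (and)
open import Data.Vec using (Vec; []; _∷_; zipWith)
open import Data.Vec.Properties using (∷-injectiveʳ)
open import Data.List using (List; []; _∷_; map; foldr; concatMap; filterᵇ; length; allFin; lookup; _++_)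
open import Data.List.Properties using (length-map; length-tabulate; length-++; map-cong; foldr-cong; filter-notAll)
open import Data.List.Relation.Unary.Any as Any using (Any; here; there)
open import Data.List.Relation.Unary.All as All using (All; []; _∷_)
import Data.List.Relation.Unary.All.Properties as AllP
import Data.List.Relation.Unary.Any.Properties as AnyP
open import Data.List.Relation.Unary.AllPairs as AllPairs using (AllPairs; []; _∷_)
import Data.List.Relation.Unary.AllPairs.Properties as AllPairsP
open import Data.List.Membership.Propositional using (_∈_; find; lose)
open import Data.List.Membership.Propositional.Properties using (∈-allFin; ∈-lookup; ∈-filter⁻; ∈-filter⁺; ∈-map⁺)
open import Data.Product using (Σ; _×_; _,_; proj₁; proj₂; ∃-syntax)
open import Data.Sum using (_⊎_; inj₁; inj₂)
open import Data.Empty using (⊥-elim)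
open import Function using (_∘_; id; Equivalence)
open import Function.Definitions using (Injective)
open import Relation.Nullary using (¬_; yes; no)
open import Relation.Nullary.Decidable using (toWitness; fromWitness; T?)
open import Relation.Binary.PropositionalEquality using (_≡_; _≢_; refl; sym; trans; cong; cong₂; subst; subst₂; _≗_; module ≡-Reasoning)

==-sound : ∀ {n} {i j : Fin n} → T (i == j) → i ≡ j
==-sound = toWitness

==-false : ∀ {n} {i j : Fin n} → i ≢ j → (i == j) ≡ false
==-false {i = i} {j} i≢j with i ≟ᶠ j
... | yes i≡j = ⊥-elim (i≢j i≡j)
... | no _ = refl

==-sym : ∀ {n} (i j : Fin n) → (i == j) ≡ (j == i)
==-sym i j with i ≟ᶠ j | j ≟ᶠ i
... | yes _ | yes _ = refl
... | no _ | no _ = refl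
... | yes i≡j | no j≢i = ⊥-elim (j≢i (sym i≡j))
... | no i≢j | yes j≡i = ⊥-elim (i≢j (sym j≡i))

T-and-map : ∀ {A : Set} (p : A → Bool) xs → T (and (map p xs)) → ∀ {x} → x ∈ xs → T (p x)
T-and-map p (y ∷ ys) h (here refl) with p y
... | true = _
T-and-map p (y ∷ ys) h (there x∈ys) with p y
... | true = T-and-map p ys h x∈ys

and-map-T : ∀ {A : Set} (p : A → Bool) xs → (∀ x → T (p x)) → T (and (map p xs))
and-map-T p [] h = _
and-map-T p (y ∷ ys) h with p y | h y
... | true | _ = and-map-T p ys h

isInjective-sound : ∀ {n m} (f : Fin n → Fin m) → T (isInjective f) → Injective _≡_ _≡_ f
isInjective-sound {n} f ok {i} {j} fi≡fj = ==-sound (from-∨ (i == j) (fromWitness fi≡fj) pair-ok)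
  where
  pair-ok : T ((i == j) ∨ not (f i == f j))
  pair-ok = T-and-map _ (allFin n) (T-and-map _ (allFin n) ok (∈-allFin i)) (∈-allFin j)
  from-∨ : ∀ b {c} → T c → T (b ∨ not c) → T b
  from-∨ true _ _ = _
  from-∨ false {true} _ ()

isInjective-complete : ∀ {n m} (f : Fin n → Fin m) → Injective _≡_ _≡_ f → T (isInjective f)
isInjective-complete {n} f inj = and-map-T _ (allFin n) (λ i → and-map-T _ (allFin n) (pair-ok i))
  where
  pair-ok : ∀ i j → T ((i == j) ∨ not (f i == f j))
  pair-ok i j with i ≟ᶠ j
  ... | yes _ = _
  ... | no i≢j rewrite ==-false (λ fi≡fj → i≢j (inj fi≡fj)) = _

T-not⇒¬T : ∀ {b} → T (not b) → ¬ T b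
T-not⇒¬T {false} _ ()

¬T-not⇒T : ∀ {b} → ¬ T (not b) → T b
¬T-not⇒T {true} _ = _
¬T-not⇒T {false} ¬T-true = ⊥-elim (¬T-true _)

-- Enumeration of all functions Fin n → Fin m. Without function extensionality
-- functions are compared pointwise; two entries of the list are never pointwise equal.

Apart : ∀ {n m} → (Fin n → Fin m) → (Fin n → Fin m) → Set
Apart f g = ∃[ i ] f i ≢ g i

allFuns-complete : ∀ n m (f : Fin n → Fin m) → Any (f ≗_) (allFuns n m)
allFuns-complete zero m f = here (λ ())
allFuns-complete (suc n) m f =
  AnyP.concatMap⁺ _ (Any.map extend (allFuns-complete n m (f ∘ suc)))
  where
  extend : ∀ {g} → f ∘ suc ≗ g → Any (f ≗_) (map _ (allFin m))
  extend f∘suc≗g = AnyP.map⁺ (Any.map (λ { refl → λ { zero → refl ; (suc k) → f∘suc≗g k } }) (∈-allFin (f zero)))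

-- Extensions of one tail differ at coordinate zero; extensions of apart tails stay apart.
allFuns-apart : ∀ n m → AllPairs Apart (allFuns n m)
allFuns-apart zero m = [] ∷ []
allFuns-apart (suc n) m =
  AllPairsP.concat⁺ (AllP.map⁺ (All.universal (λ g → AllPairsP.map⁺ (AllPairsP.tabulate⁺ λ i≢j → zero , i≢j)) (allFuns n m)))
    (AllPairsP.map⁺ (AllPairs.map apart-tails (allFuns-apart n m)))
  where
  apart-tails : ∀ {g h} → Apart g h → All (λ G → All (Apart G) (map _ (allFin m))) (map _ (allFin m))
  apart-tails (k , gk≢hk) = AllP.map⁺ (All.universal (λ i → AllP.map⁺ (All.universal (λ j → suc k , gk≢hk) (allFin m))) (allFin m))

length-concatMap-const : ∀ {A C : Set} (G : A → List C) m → (∀ x → length (G x) ≡ m) →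
                         ∀ xs → length (concatMap G xs) ≡ m * length xs
length-concatMap-const G m block [] = sym (*-zeroʳ m)
length-concatMap-const G m block (x ∷ xs) = begin
  length (G x ++ concatMap G xs)           ≡⟨ length-++ (G x) ⟩
  length (G x) + length (concatMap G xs)   ≡⟨ cong₂ _+_ (block x) (length-concatMap-const G m block xs) ⟩
  m + m * length xs                        ≡⟨ sym (*-suc m (length xs)) ⟩
  m * suc (length xs)                      ∎
  where open ≡-Reasoning

length-allFuns : ∀ n m → length (allFuns n m) ≡ m ^ n
length-allFuns zero m = refl
length-allFuns (suc n) m =
  trans (length-concatMap-const _ m (λ g → trans (length-map _ (allFin m)) (length-tabulate id)) (allFuns n m))
        (cong (m *_) (length-allFuns n m))

-- Counting list entries that pass a Boolean test; the probabilities of the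
-- theorem are ratios of such counts over the list of ID assignments.

count : ∀ {A : Set} → (A → Bool) → List A → ℕ
count p xs = length (filterᵇ p xs)

count-complement : ∀ {A : Set} (p : A → Bool) xs → count p xs + count (not ∘ p) xs ≡ length xs
count-complement p [] = refl
count-complement p (x ∷ xs) with p x
... | true = cong suc (count-complement p xs)
... | false = trans (+-suc _ _) (cong suc (count-complement p xs))

count-not : ∀ {A : Set} (p : A → Bool) xs → count (not ∘ p) xs ≡ length xs ∸ count p xs
count-not p xs = trans (sym (m+n∸m≡n (count p xs) _)) (cong (_∸ count p xs) (count-complement p xs))

count-mono : ∀ {A : Set} (p q : A → Bool) → (∀ x → T (p x) → T (q x)) → ∀ xs → count p xs ≤ count q xs
count-mono p q p⇒q [] = z≤n
count-mono p q p⇒q (x ∷ xs) with p x | q x | p⇒q x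
... | true | true | _ = s≤s (count-mono p q p⇒q xs)
... | false | true | _ = m≤n⇒m≤1+n (count-mono p q p⇒q xs)
... | false | false | _ = count-mono p q p⇒q xs
... | true | false | p⇒q-x = ⊥-elim (p⇒q-x _)

count-missing : ∀ {A : Set} (p : A → Bool) xs → Any (λ x → ¬ T (p x)) xs → count p xs ≤ pred (length xs)
count-missing p xs miss = <⇒≤pred (filter-notAll (T? ∘ p) xs miss)

count-map : ∀ {A C : Set} (p : C → Bool) (f : A → C) xs → count p (map f xs) ≡ count (p ∘ f) xs
count-map p f [] = refl
count-map p f (x ∷ xs) with p (f x)
... | true = cong suc (count-map p f xs)
... | false = count-map p f xs

count-∧-const : ∀ {A : Set} (p : A → Bool) b xs → count (λ x → p x ∧ b) xs ≡ (if b then count p xs else 0)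
count-∧-const p true [] = refl
count-∧-const p false [] = refl
count-∧-const p b (x ∷ xs) with p x | b | count-∧-const p b xs
... | true | true | ih = cong suc ih
... | true | false | ih = ih
... | false | true | ih = ih
... | false | false | ih = ih

count-++ : ∀ {A : Set} (p : A → Bool) xs ys → count p (xs ++ ys) ≡ count p xs + count p ys
count-++ p [] ys = refl
count-++ p (x ∷ xs) ys with p x
... | true = cong suc (count-++ p xs ys)
... | false = count-++ p xs ys

count-concatMap : ∀ {A C : Set} (p : C → Bool) (q : A → Bool) (G : A → List C) c →
                  (∀ x → count p (G x) ≡ (if q x then c else 0)) →
                  ∀ xs → count p (concatMap G xs) ≡ c * count q xs
count-concatMap p q G c block [] = sym (*-zeroʳ c)
count-concatMap p q G c block (x ∷ xs) =
  trans (count-++ p (G x) (concatMap G xs))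
        (trans (cong₂ _+_ (block x) (count-concatMap p q G c block xs)) hit-or-miss)
  where
  hit-or-miss : (if q x then c else 0) + c * count q xs ≡ c * count q (x ∷ xs)
  hit-or-miss with q x
  ... | true = sym (*-suc c (count q xs))
  ... | false = refl

everywhere : ∀ {M B} → (Fin M → Fin B → Bool) → (Fin M → Fin B) → Bool
everywhere {zero} F e = true
everywhere {suc M} F e = F zero (e zero) ∧ everywhere (F ∘ suc) (e ∘ suc)

count-everywhere : ∀ M B (F : Fin M → Fin B → Bool) K → (∀ c → count (F c) (allFin B) ≤ K) →
                   count (everywhere F) (allFuns M B) ≤ K ^ M
count-everywhere zero B F K bound = ≤-refl
count-everywhere (suc M) B F K bound = begin
  count (everywhere F) (allFuns (suc M) B)
    ≡⟨ count-concatMap (everywhere F) (everywhere (F ∘ suc)) _ (count (F zero) (allFin B)) row (allFuns M B) ⟩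
  count (F zero) (allFin B) * count (everywhere (F ∘ suc)) (allFuns M B)
    ≤⟨ *-mono-≤ (bound zero) (count-everywhere M B (F ∘ suc) K (bound ∘ suc)) ⟩
  K * K ^ M ∎
  where
  open ≤-Reasoning
  row : ∀ f → count (everywhere F) (map _ (allFin B)) ≡ (if everywhere (F ∘ suc) f then count (F zero) (allFin B) else 0)
  row f = trans (count-map (everywhere F) _ (allFin B)) (count-∧-const (F zero) (everywhere (F ∘ suc) f) (allFin B))

everywhere-violated : ∀ {M B} (F : Fin M → Fin B → Bool) e → ¬ T (everywhere F e) → Σ (Fin M) λ c → ¬ T (F c (e c))
everywhere-violated {zero} F e violated = ⊥-elim (violated _)
everywhere-violated {suc M} F e violated with F zero (e zero) in F-at-zero
... | false = zero , λ holds → subst T F-at-zero holds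
... | true with everywhere-violated (F ∘ suc) (e ∘ suc) violated
...   | c , bad = suc c , bad

sum-count-cons : ∀ {A C : Set} (Q : C → A → Bool) x L E →
                 sum (map (λ e → count (Q e) (x ∷ L)) E) ≡ count (λ e → Q e x) E + sum (map (λ e → count (Q e) L) E)
sum-count-cons Q x L [] = refl
sum-count-cons Q x L (e ∷ E) with Q e x
... | true = cong suc (move-past (count (Q e) L))
  where
  move-past : ∀ a → a + sum (map (λ e → count (Q e) (x ∷ L)) E) ≡ count (λ e → Q e x) E + (a + sum (map (λ e → count (Q e) L) E))
  move-past a = trans (cong (a +_) (sum-count-cons Q x L E)) (x+[y+z]≡y+[x+z] a (count (λ e → Q e x) E) _)
... | false = trans (cong (count (Q e) L +_) (sum-count-cons Q x L E)) (x+[y+z]≡y+[x+z] (count (Q e) L) (count (λ e → Q e x) E) _)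

sum-zeros : ∀ {C : Set} (E : List C) → sum (map (λ _ → 0) E) ≡ 0
sum-zeros [] = refl
sum-zeros (e ∷ E) = sum-zeros E

double-count : ∀ {A C : Set} (Q : C → A → Bool) L E →
               sum (map (λ x → count (λ e → Q e x) E) L) ≡ sum (map (λ e → count (Q e) L) E)
double-count Q [] E = sym (sum-zeros E)
double-count Q (x ∷ L) E = trans (cong (count (λ e → Q e x) E +_) (double-count Q L E)) (sym (sum-count-cons Q x L E))

sum-≥ : ∀ {A : Set} (f : A → ℕ) r xs → (∀ x → x ∈ xs → r ≤ f x) → r * length xs ≤ sum (map f xs)
sum-≥ f r [] _ = ≤-reflexive (*-zeroʳ r)
sum-≥ f r (x ∷ xs) lower =
  ≤-trans (≤-reflexive (*-suc r (length xs))) (+-mono-≤ (lower x (here refl)) (sum-≥ f r xs (λ y y∈xs → lower y (there y∈xs))))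

sum-≤ : ∀ {A : Set} (f : A → ℕ) c xs → (∀ x → x ∈ xs → f x ≤ c) → sum (map f xs) ≤ length xs * c
sum-≤ f c [] _ = z≤n
sum-≤ f c (x ∷ xs) upper = +-mono-≤ (upper x (here refl)) (sum-≤ f c xs (λ y y∈xs → upper y (there y∈xs)))

averaging : ∀ {A C : Set} (Q : C → A → Bool) L E r c →
            (∀ x → x ∈ L → r ≤ count (λ e → Q e x) E) → (∀ e → e ∈ E → count (Q e) L ≤ c) →
            r * length L ≤ length E * c
averaging Q L E r c many few = begin
  r * length L                                   ≤⟨ sum-≥ _ r L many ⟩
  sum (map (λ x → count (λ e → Q e x) E) L)      ≡⟨ double-count Q L E ⟩
  sum (map (λ e → count (Q e) L) E)              ≤⟨ sum-≤ _ c E few ⟩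
  length E * c                                   ∎
  where open ≤-Reasoning

idAssignment-injective : ∀ {n σ} → σ ∈ idAssignments n → Injective _≡_ _≡_ σ
idAssignment-injective {n} σ∈ = isInjective-sound _ (proj₂ (∈-filter⁻ (T? ∘ isInjective) {xs = allFuns n n} σ∈))

idAssignments-complete : ∀ {n} (σ : Fin n → Fin n) → Injective _≡_ _≡_ σ → Any (σ ≗_) (idAssignments n)
idAssignments-complete {n} σ σ-inj with find (allFuns-complete n n σ)
... | τ , τ∈ , σ≗τ = lose (∈-filter⁺ (T? ∘ isInjective) τ∈ (isInjective-complete τ τ-inj)) σ≗τ
  where
  τ-inj : Injective _≡_ _≡_ τ
  τ-inj {i} {j} τi≡τj = σ-inj (trans (σ≗τ i) (trans τi≡τj (sym (σ≗τ j))))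

idAssignments-apart : ∀ n → AllPairs (λ σ τ → ¬ σ ≗ τ) (idAssignments n)
idAssignments-apart n =
  AllPairsP.filter⁺ (T? ∘ isInjective) (AllPairs.map (λ { (i , σi≢τi) σ≗τ → σi≢τi (σ≗τ i) }) (allFuns-apart n n))

module _ {A : Set} (_≈_ : A → A → Set)
         (≈-sym : ∀ {a b} → a ≈ b → b ≈ a) (≈-trans : ∀ {a b c} → a ≈ b → b ≈ c → a ≈ c) where

  lookup-apart : ∀ {xs : List A} → AllPairs (λ a b → ¬ a ≈ b) xs → ∀ i j → lookup xs i ≈ lookup xs j → i ≡ j
  lookup-apart (_ ∷ _) zero zero _ = refl
  lookup-apart (x≉xs ∷ _) zero (suc j) x≈ = ⊥-elim (All.lookup x≉xs (∈-lookup j) x≈)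
  lookup-apart (x≉xs ∷ _) (suc i) zero ≈x = ⊥-elim (All.lookup x≉xs (∈-lookup i) (≈-sym ≈x))
  lookup-apart (_ ∷ apart) (suc i) (suc j) eq = cong suc (lookup-apart apart i j eq)

  injection-bound : (F : A → A) (xs ys : List A) → AllPairs (λ a b → ¬ a ≈ b) xs →
                    (∀ x → x ∈ xs → Any (F x ≈_) ys) → (∀ a b → F a ≈ F b → a ≈ b) → length xs ≤ length ys
  injection-bound F xs ys apart into reflects = injective⇒≤ {f = position} position-injective
    where
    position : Fin (length xs) → Fin (length ys)
    position i = Any.index (into (lookup xs i) (∈-lookup i))
    lands : ∀ i → F (lookup xs i) ≈ lookup ys (position i)
    lands i = AnyP.lookup-index (into (lookup xs i) (∈-lookup i))
    position-injective : ∀ {i j} → position i ≡ position j → i ≡ j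
    position-injective {i} {j} same =
      lookup-apart apart i j (reflects _ _ (≈-trans (lands i) (≈-sym (subst (λ k → F (lookup xs j) ≈ lookup ys k) (sym same) (lands j)))))

relabel-count : ∀ {n} (h g : Fin n → Fin n) → (∀ i → h (g i) ≡ i) → (∀ i → g (h i) ≡ i) →
                (P : (Fin n → Fin n) → Bool) → (∀ σ τ → σ ≗ τ → P σ ≡ P τ) →
                count (λ σ → P (σ ∘ h)) (idAssignments n) ≤ count P (idAssignments n)
relabel-count {n} h g hg≗id gh≗id P P-resp =
  injection-bound _≗_ (λ e i → sym (e i)) (λ e f i → trans (e i) (f i)) (_∘ h) _ _
    (AllPairsP.filter⁺ _ (idAssignments-apart n)) lands reflects
  where
  reflects : ∀ σ τ → σ ∘ h ≗ τ ∘ h → σ ≗ τ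
  reflects σ τ σh≗τh i = trans (cong σ (sym (hg≗id i))) (trans (σh≗τh (g i)) (cong τ (hg≗id i)))
  σh-injective : ∀ {σ} → Injective _≡_ _≡_ σ → Injective _≡_ _≡_ (σ ∘ h)
  σh-injective σ-inj {i} {j} eq = trans (sym (gh≗id i)) (trans (cong g (σ-inj eq)) (gh≗id j))
  lands : ∀ σ → σ ∈ filterᵇ (λ σ → P (σ ∘ h)) (idAssignments n) → Any (σ ∘ h ≗_) (filterᵇ P (idAssignments n))
  lands σ σ∈ with ∈-filter⁻ (T? ∘ (λ σ → P (σ ∘ h))) {xs = idAssignments n} σ∈
  ... | σ∈ids , Pσh with find (idAssignments-complete (σ ∘ h) (σh-injective (idAssignment-injective σ∈ids)))
  ... | τ , τ∈ , σh≗τ = lose (∈-filter⁺ (T? ∘ P) τ∈ (subst T (P-resp _ _ σh≗τ) Pσh)) σh≗τ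

inClosedNbhd : ∀ {n} → Graph n → Fin n → Fin n → Bool
inClosedNbhd G v u = (u == v) ∨ adj G v u

module RunningMinimum {A : Set} (ok : A → Bool) (f : A → ℕ) where

  keepBetter : A → A → A
  keepBetter u best = if ok u ∧ (f u <ᵇ f best) then u else best

  runMin-ok : ∀ b L → T (ok b) → T (ok (foldr keepBetter b L))
  runMin-ok b [] ok-b = ok-b
  runMin-ok b (u ∷ L) ok-b with ok u in ok-u | f u <ᵇ f (foldr keepBetter b L)
  ... | true | true = subst T (sym ok-u) _
  ... | true | false = runMin-ok b L ok-b
  ... | false | _ = runMin-ok b L ok-b

  runMin-≤ : ∀ b L {u} → u ∈ L → T (ok u) → f (foldr keepBetter b L) ≤ f u
  runMin-≤ b (u ∷ L) (here refl) ok-u with ok u | f u <ᵇ f (foldr keepBetter b L) in u≮best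
  ... | true | true = ≤-refl
  ... | true | false = ≮⇒≥ (λ u<best → subst T u≮best (<⇒<ᵇ u<best))
  runMin-≤ b (u ∷ L) (there u'∈L) ok-u' with ok u | f u <ᵇ f (foldr keepBetter b L) in u<best
  ... | true | true = ≤-trans (<⇒≤ (<ᵇ⇒< _ _ (subst T (sym u<best) _))) (runMin-≤ b L u'∈L ok-u')
  ... | true | false = runMin-≤ b L u'∈L ok-u'
  ... | false | _ = runMin-≤ b L u'∈L ok-u'

parent-unique : ∀ {n} (G : Graph n) (σ : Fin n → Fin n) v → Injective _≡_ _≡_ σ →
                ∀ w → T (inClosedNbhd G v w) → (∀ u → T (inClosedNbhd G v u) → toℕ (σ w) ≤ toℕ (σ u)) →
                parent G σ v ≡ w
parent-unique {n} G σ v σ-inj w w-near w-min = σ-inj (toℕ-injective (≤-antisym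
  (runMin-≤ v (allFin n) (∈-allFin w) w-near) (w-min _ (runMin-ok v (allFin n) v-near))))
  where
  open RunningMinimum (inClosedNbhd G v) (toℕ ∘ σ)
  v-near : T (inClosedNbhd G v v)
  v-near = Equivalence.from (T-∨ {v == v}) (inj₁ (fromWitness {a? = v ≟ᶠ v} refl))

pathLenFuel-walk : ∀ {n} (G : Graph n) (σ : Fin n → Fin n) k (w : ℕ → Fin n) F → k ≤ F →
                   (∀ j → j < k → parent G σ (w j) ≡ w (suc j)) → (∀ j → j < k → w (suc j) ≢ w j) →
                   k ≤ pathLenFuel G σ F (w 0)
pathLenFuel-walk G σ zero w F _ _ _ = z≤n
pathLenFuel-walk G σ (suc k) w (suc F) (s≤s k≤F) step moves
  rewrite step 0 z<s | ==-false (moves 0 z<s) =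
  s≤s (pathLenFuel-walk G σ k (w ∘ suc) F k≤F (λ j j<k → step (suc j) (s≤s j<k)) (λ j j<k → moves (suc j) (s≤s j<k)))

maximum-≥ : ∀ {x} xs → x ∈ xs → x ≤ foldr _⊔_ 0 xs
maximum-≥ (y ∷ ys) (here refl) = m≤m⊔n y _
maximum-≥ (y ∷ ys) (there x∈ys) = ≤-trans (maximum-≥ ys x∈ys) (m≤n⊔m y _)

longestPath-≥ : ∀ {n} (G : Graph n) σ (v : Fin n) → pathLen G σ v ≤ longestPath G σ
longestPath-≥ {n} G σ v = maximum-≥ (map (pathLen G σ) (allFin n)) (∈-map⁺ (pathLen G σ) (∈-allFin v))

parent-resp : ∀ {n} (G : Graph n) σ τ → σ ≗ τ → ∀ v → parent G σ v ≡ parent G τ v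
parent-resp {n} G σ τ σ≗τ v = foldr-cong same-pick refl (allFin n)
  where
  same-pick : ∀ u b → RunningMinimum.keepBetter (inClosedNbhd G v) (toℕ ∘ σ) u b
                    ≡ RunningMinimum.keepBetter (inClosedNbhd G v) (toℕ ∘ τ) u b
  same-pick u b = cong (λ t → if inClosedNbhd G v u ∧ t then u else b) (cong₂ _<ᵇ_ (cong toℕ (σ≗τ u)) (cong toℕ (σ≗τ b)))

pathLenFuel-resp : ∀ {n} (G : Graph n) σ τ → σ ≗ τ → ∀ F v → pathLenFuel G σ F v ≡ pathLenFuel G τ F v
pathLenFuel-resp G σ τ σ≗τ zero v = refl
pathLenFuel-resp G σ τ σ≗τ (suc F) v rewrite parent-resp G σ τ σ≗τ v =
  cong (λ len → if parent G τ v == v then 0 else suc len) (pathLenFuel-resp G σ τ σ≗τ F (parent G τ v))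

longestPath-resp : ∀ {n} (G : Graph n) σ τ → σ ≗ τ → longestPath G σ ≡ longestPath G τ
longestPath-resp {n} G σ τ σ≗τ = cong (foldr _⊔_ 0) (map-cong (pathLenFuel-resp G σ τ σ≗τ n) (allFin n))

-- The level of x is the position of
-- its first true bit counted from the right end (0 for the zero vector), so level j ≥ 1
-- has 2^(j-1) members; the gadget joins vertices on consecutive levels.

Cube : ℕ → Set
Cube k = Vec Bool k

level : ∀ {k} → Cube k → ℕ
level [] = 0
level {suc k} (true ∷ x) = suc k
level (false ∷ x) = level x

level-≤ : ∀ {k} (x : Cube k) → level x ≤ k
level-≤ [] = z≤n
level-≤ (true ∷ x) = ≤-refl
level-≤ (false ∷ x) = m≤n⇒m≤1+n (level-≤ x)

levelAdjacent : ∀ {k} → Cube k → Cube k → Bool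
levelAdjacent x y = (level x ≡ᵇ suc (level y)) ∨ (level y ≡ᵇ suc (level x))

bottom top : ∀ {k} → (Cube (suc k) → ℕ) → Cube k → ℕ
bottom τ x = τ (false ∷ x)
top τ x = τ (true ∷ x)

cubeMin : ∀ {k} → (Cube k → ℕ) → ℕ
cubeMin {zero} τ = τ []
cubeMin {suc k} τ = cubeMin (bottom τ) ⊓ cubeMin (top τ)

cubeMin-≤ : ∀ {k} (τ : Cube k → ℕ) x → cubeMin τ ≤ τ x
cubeMin-≤ τ [] = ≤-refl
cubeMin-≤ τ (false ∷ x) = ≤-trans (m⊓n≤m _ _) (cubeMin-≤ (bottom τ) x)
cubeMin-≤ τ (true ∷ x) = ≤-trans (m⊓n≤n _ _) (cubeMin-≤ (top τ) x)

cubeMin-attained : ∀ {k} (τ : Cube k → ℕ) → Σ (Cube k) λ x → cubeMin τ ≡ τ x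
cubeMin-attained {zero} τ = [] , refl
cubeMin-attained {suc k} τ with cubeMin-attained (bottom τ) | cubeMin-attained (top τ) | ⊓-sel (cubeMin (bottom τ)) (cubeMin (top τ))
... | x , min≡τx | _ | inj₁ bottom-wins = false ∷ x , trans bottom-wins min≡τx
... | _ | y , min≡τy | inj₂ top-wins = true ∷ y , trans top-wins min≡τy

argmin : ∀ {k} → (Cube k → ℕ) → Cube k
argmin τ = proj₁ (cubeMin-attained τ)

-- τ is ascending when, recursively, the top half's minimum is below the bottom half's:
-- then each level's minimum beats everything on the levels below it.
ascending : ∀ {k} → (Cube k → ℕ) → Bool
ascending {zero} τ = true
ascending {suc k} τ = (cubeMin (top τ) <ᵇ cubeMin (bottom τ)) ∧ ascending (bottom τ)

_⊕_ : ∀ {k} → Cube k → Cube k → Cube k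
_⊕_ = zipWith _xor_

⊕-involutive : ∀ {k} (x e : Cube k) → (x ⊕ e) ⊕ e ≡ x
⊕-involutive [] [] = refl
⊕-involutive (a ∷ x) (b ∷ e) = cong₂ _∷_ cancel (⊕-involutive x e)
  where
  cancel : (a xor b) xor b ≡ a
  cancel = trans (xor-assoc a b b) (trans (cong (a xor_) (xor-same b)) (xor-identityʳ a))

cubeMin-mask : ∀ {k} (τ : Cube k → ℕ) e → cubeMin (λ x → τ (x ⊕ e)) ≡ cubeMin τ
cubeMin-mask {zero} τ [] = refl
cubeMin-mask {suc k} τ (false ∷ e) = cong₂ _⊓_ (cubeMin-mask (bottom τ) e) (cubeMin-mask (top τ) e)
cubeMin-mask {suc k} τ (true ∷ e) = trans (cong₂ _⊓_ (cubeMin-mask (top τ) e) (cubeMin-mask (bottom τ) e)) (⊓-comm _ _)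

-- Every injective ranking becomes ascending after a suitable mask: at each step, flip
-- the leading bit if needed so that the half holding the overall minimum is on top.
mask-to-ascending : ∀ {k} (τ : Cube k → ℕ) → Injective _≡_ _≡_ τ → Σ (Cube k) λ e → T (ascending (λ x → τ (x ⊕ e)))
mask-to-ascending {zero} τ _ = [] , _
mask-to-ascending {suc k} τ τ-inj with cubeMin (top τ) <? cubeMin (bottom τ)
... | yes top<bottom with mask-to-ascending (bottom τ) (∷-injectiveʳ ∘ τ-inj)
...   | e , asc = false ∷ e , Equivalence.from T-∧ (<⇒<ᵇ (subst₂ _<_ (sym (cubeMin-mask (top τ) e)) (sym (cubeMin-mask (bottom τ) e)) top<bottom) , asc)
mask-to-ascending {suc k} τ τ-inj | no top≮bottom with mask-to-ascending (top τ) (∷-injectiveʳ ∘ τ-inj)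
...   | e , asc = true ∷ e , Equivalence.from T-∧ (<⇒<ᵇ (subst₂ _<_ (sym (cubeMin-mask (bottom τ) e)) (sym (cubeMin-mask (top τ) e)) bottom<top) , asc)
  where
  halves-differ : cubeMin (bottom τ) ≢ cubeMin (top τ)
  halves-differ same with cubeMin-attained (bottom τ) | cubeMin-attained (top τ)
  ... | x , bx | y , ty with τ-inj (trans (sym bx) (trans same ty))
  ... | ()
  bottom<top : cubeMin (bottom τ) < cubeMin (top τ)
  bottom<top = ≤∧≢⇒< (≮⇒≥ top≮bottom) halves-differ

-- The minimum of τ on level j (for j ≤ k): the rungs of the ladder climbed by the parents.
levelMin : ∀ {k} → (Cube k → ℕ) → ℕ → Cube k
levelMin {zero} τ j = []
levelMin {suc k} τ j with j ≤? k
... | yes _ = false ∷ levelMin (bottom τ) j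
... | no _ = true ∷ argmin (top τ)

levelMin-level : ∀ {k} (τ : Cube k → ℕ) j → j ≤ k → level (levelMin τ j) ≡ j
levelMin-level {zero} τ zero _ = refl
levelMin-level {suc k} τ j j≤1+k with j ≤? k
... | yes j≤k = levelMin-level (bottom τ) j j≤k
... | no j≰k = ≤-antisym (≰⇒> j≰k) j≤1+k

levelMin-≤ : ∀ {k} (τ : Cube k → ℕ) j → j ≤ k → ∀ y → level y ≡ j → τ (levelMin τ j) ≤ τ y
levelMin-≤ {zero} τ j _ [] _ = ≤-refl
levelMin-≤ {suc k} τ j j≤1+k (false ∷ y) y-on-j with j ≤? k
... | yes j≤k = levelMin-≤ (bottom τ) j j≤k y y-on-j
... | no j≰k = ⊥-elim (j≰k (subst (_≤ k) y-on-j (level-≤ y)))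
levelMin-≤ {suc k} τ j j≤1+k (true ∷ y) y-on-j with j ≤? k
... | yes j≤k = ⊥-elim (1+n≰n (subst (_≤ k) (sym y-on-j) j≤k))
... | no _ = subst (_≤ top τ y) (proj₂ (cubeMin-attained (top τ))) (cubeMin-≤ (top τ) y)

ascending-climbs : ∀ {k} (τ : Cube k → ℕ) → T (ascending τ) →
                   ∀ j j' → j < j' → j' ≤ k → ∀ y → level y ≡ j → τ (levelMin τ j') < τ y
ascending-climbs {zero} τ asc j j' j<j' j'≤0 [] refl = ⊥-elim (<⇒≱ j<j' j'≤0)
ascending-climbs {suc k} τ asc j j' j<j' j'≤1+k (true ∷ y) refl = ⊥-elim (<⇒≱ j<j' j'≤1+k)
ascending-climbs {suc k} τ asc j j' j<j' j'≤1+k (false ∷ y) refl with j' ≤? k | Equivalence.to T-∧ asc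
... | yes j'≤k | _ , bottom-asc = ascending-climbs (bottom τ) bottom-asc j j' j<j' j'≤k y refl
... | no _ | top<bottom , _ = begin-strict
  top τ (argmin (top τ))   ≡⟨ sym (proj₂ (cubeMin-attained (top τ))) ⟩
  cubeMin (top τ)          <⟨ <ᵇ⇒< _ _ top<bottom ⟩
  cubeMin (bottom τ)       ≤⟨ cubeMin-≤ (bottom τ) y ⟩
  bottom τ y               ∎
  where open ≤-Reasoning

levelAdjacent-up : ∀ {k} (x y : Cube k) → level y ≡ suc (level x) → T (levelAdjacent x y)
levelAdjacent-up x y up = Equivalence.from (T-∨ {level x ≡ᵇ suc (level y)}) (inj₂ (≡⇒≡ᵇ _ _ up))

levelAdjacent-sound : ∀ {k} (x y : Cube k) → T (levelAdjacent x y) → level x ≡ suc (level y) ⊎ level y ≡ suc (level x)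
levelAdjacent-sound x y adjacent with Equivalence.to (T-∨ {level x ≡ᵇ suc (level y)}) adjacent
... | inj₁ down = inj₁ (≡ᵇ⇒≡ _ _ down)
... | inj₂ up = inj₂ (≡ᵇ⇒≡ _ _ up)

levelAdjacent-irrefl : ∀ {k} (x : Cube k) → levelAdjacent x x ≡ false
levelAdjacent-irrefl x with levelAdjacent x x in adjacent
... | false = refl
... | true with levelAdjacent-sound x x (subst T (sym adjacent) _)
...   | inj₁ loop = ⊥-elim (1+n≢n (sym loop))
...   | inj₂ loop = ⊥-elim (1+n≢n (sym loop))

levelMin-step : ∀ {k} (τ : Cube k → ℕ) → T (ascending τ) → ∀ j → j < k →
                ∀ y → y ≡ levelMin τ j ⊎ T (levelAdjacent (levelMin τ j) y) → τ (levelMin τ (suc j)) ≤ τ y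
levelMin-step τ asc j j<k y (inj₁ refl) =
  <⇒≤ (ascending-climbs τ asc j (suc j) (n<1+n j) j<k y (levelMin-level τ j (<⇒≤ j<k)))
levelMin-step τ asc j j<k y (inj₂ adjacent) with levelAdjacent-sound (levelMin τ j) y adjacent
... | inj₁ down = <⇒≤ (ascending-climbs τ asc (level y) (suc j) y<1+j j<k y refl)
  where
  y<1+j : level y < suc j
  y<1+j = m<n⇒m<1+n (≤-reflexive (trans (sym down) (levelMin-level τ j (<⇒≤ j<k))))
... | inj₂ up = levelMin-≤ τ (suc j) j<k y (trans up (cong suc (levelMin-level τ j (<⇒≤ j<k))))

levelMin-moves : ∀ {k} (τ : Cube k → ℕ) j → j < k → levelMin τ (suc j) ≢ levelMin τ j
levelMin-moves τ j j<k same =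
  1+n≢n (trans (sym (levelMin-level τ (suc j) j<k)) (trans (cong level same) (levelMin-level τ j (<⇒≤ j<k))))

levelMin-adjacent : ∀ {k} (τ : Cube k → ℕ) j → j < k → T (levelAdjacent (levelMin τ j) (levelMin τ (suc j)))
levelMin-adjacent τ j j<k =
  levelAdjacent-up (levelMin τ j) (levelMin τ (suc j)) (trans (levelMin-level τ (suc j) j<k) (cong suc (sym (levelMin-level τ j (<⇒≤ j<k)))))

bit : Bool → Fin 2
bit false = zero
bit true = suc zero

fromBit : Fin 2 → Bool
fromBit zero = false
fromBit (suc zero) = true

toFin : ∀ {k} → Cube k → Fin (2 ^ k)
toFin [] = zero
toFin (b ∷ x) = combine (bit b) (toFin x)

fromFin : ∀ {k} → Fin (2 ^ k) → Cube k
fromFin {zero} _ = []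
fromFin {suc k} i = fromBit (quotient (2 ^ k) i) ∷ fromFin (remainder {2} (2 ^ k) i)

fromFin-toFin : ∀ {k} (x : Cube k) → fromFin (toFin x) ≡ x
fromFin-toFin [] = refl
fromFin-toFin {suc k} (b ∷ x) =
  trans (cong (λ qr → fromBit (proj₁ qr) ∷ fromFin (proj₂ qr)) (remQuot-combine {k = 2 ^ k} (bit b) (toFin x)))
        (cong₂ _∷_ (fromBit-bit b) (fromFin-toFin x))
  where
  fromBit-bit : ∀ b → fromBit (bit b) ≡ b
  fromBit-bit false = refl
  fromBit-bit true = refl

toFin-fromFin : ∀ {k} (i : Fin (2 ^ k)) → toFin (fromFin {k} i) ≡ i
toFin-fromFin {zero} zero = refl
toFin-fromFin {suc k} i = begin
  combine (bit (fromBit q)) (toFin (fromFin {k} r))   ≡⟨ cong₂ combine (bit-fromBit q) (toFin-fromFin {k} r) ⟩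
  combine q r                                        ≡⟨ combine-remQuot {2} (2 ^ k) i ⟩
  i                                                  ∎
  where
  open ≡-Reasoning
  q : Fin 2
  q = quotient (2 ^ k) i
  r : Fin (2 ^ k)
  r = remainder {2} (2 ^ k) i
  bit-fromBit : ∀ c → bit (fromBit c) ≡ c
  bit-fromBit zero = refl
  bit-fromBit (suc zero) = refl

module Construction (k : ℕ) where

  B N : ℕ
  B = 2 ^ k
  N = B * B

  copy : Fin N → Fin B
  copy i = quotient B i

  position : Fin N → Cube k
  position i = fromFin (remainder {B} B i)

  vertex : Fin B → Cube k → Fin N
  vertex c x = combine c (toFin x)

  copy-vertex : ∀ c x → copy (vertex c x) ≡ c
  copy-vertex c x = cong proj₁ (remQuot-combine {B} {B} c (toFin x))

  position-vertex : ∀ c x → position (vertex c x) ≡ x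
  position-vertex c x = trans (cong (fromFin ∘ proj₂) (remQuot-combine {B} {B} c (toFin x))) (fromFin-toFin x)

  vertex-decode : ∀ i → vertex (copy i) (position i) ≡ i
  vertex-decode i = trans (cong (combine (copy i)) (toFin-fromFin {k} (remainder {B} B i))) (combine-remQuot {B} B i)

  Gk : Graph N
  Gk = record
    { adj = λ i j → (copy i == copy j) ∧ levelAdjacent (position i) (position j)
    ; sym = λ i j → cong₂ _∧_ (==-sym (copy i) (copy j)) (∨-comm (level (position i) ≡ᵇ suc (level (position j))) _)
    ; irrefl = λ i → trans (cong ((copy i == copy i) ∧_) (levelAdjacent-irrefl (position i))) (∧-zeroʳ _)
    }

  nbhd-decode : ∀ c x u → T (inClosedNbhd Gk (vertex c x) u) →
                Σ (Cube k) λ y → u ≡ vertex c y × (y ≡ x ⊎ T (levelAdjacent x y))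
  nbhd-decode c x u near with Equivalence.to (T-∨ {u == vertex c x}) near
  ... | inj₁ u==v = x , ==-sound u==v , inj₁ refl
  ... | inj₂ adjacent with Equivalence.to T-∧ adjacent
  ...   | same-copy , levels =
    position u , trans (sym (vertex-decode u)) (cong (λ c' → vertex c' (position u)) u-in-c) ,
    inj₂ (subst (λ x' → T (levelAdjacent x' (position u))) (position-vertex c x) levels)
    where
    u-in-c : copy u ≡ c
    u-in-c = trans (sym (==-sound same-copy)) (copy-vertex c x)

  nbhd-encode : ∀ c x y → T (levelAdjacent x y) → T (inClosedNbhd Gk (vertex c x) (vertex c y))
  nbhd-encode c x y adjacent = Equivalence.from (T-∨ {vertex c y == vertex c x}) (inj₂ (Equivalence.from T-∧ (same-copy , levels)))
    where
    same-copy : T (copy (vertex c x) == copy (vertex c y))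
    same-copy = fromWitness (trans (copy-vertex c x) (sym (copy-vertex c y)))
    levels : T (levelAdjacent (position (vertex c x)) (position (vertex c y)))
    levels = subst₂ (λ x' y' → T (levelAdjacent x' y')) (sym (position-vertex c x)) (sym (position-vertex c y)) adjacent

  k≤N : k ≤ N
  k≤N = ≤-trans (n≤2^n k) (m≤m*n B B {{>-nonZero (m^n>0 2 k)}})
    where
    n≤2^n : ∀ n → n ≤ 2 ^ n
    n≤2^n zero = z≤n
    n≤2^n (suc n) = +-mono-≤ (m^n>0 2 n) (≤-trans (n≤2^n n) (m≤m+n (2 ^ n) 0))

  ladder-path : (σ : Fin N → Fin N) → Injective _≡_ _≡_ σ → ∀ c (τ : Cube k → ℕ) → T (ascending τ) →
                (∀ y → τ y ≡ toℕ (σ (vertex c y))) → k ≤ longestPath Gk σ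
  ladder-path σ σ-inj c τ asc τ≡σ =
    ≤-trans (pathLenFuel-walk Gk σ k rung N k≤N climb moves) (longestPath-≥ Gk σ (rung 0))
    where
    rung : ℕ → Fin N
    rung j = vertex c (levelMin τ j)
    lowest : ∀ j → j < k → ∀ u → T (inClosedNbhd Gk (rung j) u) → toℕ (σ (rung (suc j))) ≤ toℕ (σ u)
    lowest j j<k u near with nbhd-decode c (levelMin τ j) u near
    ... | y , refl , y-near = subst₂ _≤_ (τ≡σ _) (τ≡σ y) (levelMin-step τ asc j j<k y y-near)
    climb : ∀ j → j < k → parent Gk σ (rung j) ≡ rung (suc j)
    climb j j<k = parent-unique Gk σ (rung j) σ-inj (rung (suc j))
      (nbhd-encode c (levelMin τ j) (levelMin τ (suc j)) (levelMin-adjacent τ j j<k)) (lowest j j<k)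
    moves : ∀ j → j < k → rung (suc j) ≢ rung j
    moves j j<k same =
      levelMin-moves τ j j<k (trans (sym (position-vertex c (levelMin τ (suc j)))) (trans (cong position same) (position-vertex c (levelMin τ j))))

  masked : (Fin B → Fin B) → Fin N → Fin N
  masked e i = vertex (copy i) (position i ⊕ fromFin (e (copy i)))

  masked-vertex : ∀ e c y → masked e (vertex c y) ≡ vertex c (y ⊕ fromFin (e c))
  masked-vertex e c y rewrite copy-vertex c y | position-vertex c y = refl

  masked-involutive : ∀ e i → masked e (masked e i) ≡ i
  masked-involutive e i = begin
    masked e (masked e i)                                                    ≡⟨ masked-vertex e (copy i) (position i ⊕ fromFin (e (copy i))) ⟩
    vertex (copy i) ((position i ⊕ fromFin (e (copy i))) ⊕ fromFin (e (copy i))) ≡⟨ cong (vertex (copy i)) (⊕-involutive (position i) _) ⟩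
    vertex (copy i) (position i)                                             ≡⟨ vertex-decode i ⟩
    i                                                                        ∎
    where open ≡-Reasoning

  climbs : (Fin N → Fin N) → Fin B → Fin B → Bool
  climbs σ c m = ascending (λ y → toℕ (σ (vertex c (y ⊕ fromFin m))))

  masked-path : (σ : Fin N → Fin N) → Injective _≡_ _≡_ σ → ∀ e c → T (climbs σ c (e c)) →
                k ≤ longestPath Gk (σ ∘ masked e)
  masked-path σ σ-inj e c asc =
    ladder-path (σ ∘ masked e) σe-inj c _ asc (λ y → cong (toℕ ∘ σ) (sym (masked-vertex e c y)))
    where
    σe-inj : Injective _≡_ _≡_ (σ ∘ masked e)
    σe-inj {i} {j} same = trans (sym (masked-involutive e i)) (trans (cong (masked e) (σ-inj same)) (masked-involutive e j))

  copy-ranking-injective : (σ : Fin N → Fin N) → Injective _≡_ _≡_ σ → ∀ c → Injective _≡_ _≡_ (λ y → toℕ (σ (vertex c y)))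
  copy-ranking-injective σ σ-inj c {x} {y} same =
    trans (sym (position-vertex c x)) (trans (cong position (σ-inj (toℕ-injective same))) (position-vertex c y))

  some-mask-climbs : (σ : Fin N → Fin N) → Injective _≡_ _≡_ σ → ∀ c → Σ (Fin B) λ m → T (climbs σ c m)
  some-mask-climbs σ σ-inj c with mask-to-ascending (λ y → toℕ (σ (vertex c y))) (copy-ranking-injective σ σ-inj c)
  ... | e , asc = toFin e , subst (λ e' → T (ascending (λ y → toℕ (σ (vertex c (y ⊕ e')))))) (sym (fromFin-toFin e)) asc

-- Bernoulli's inequality (1 + 1/x)^M ≥ 1 + M/x, cleared of denominators.
bernoulli : ∀ x M → x ^ M * (x + M) ≤ suc x ^ M * x
bernoulli x zero = ≤-reflexive (cong (_+ 0) (+-identityʳ x))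
bernoulli x (suc M) = begin
  x ^ suc M * (x + suc M)               ≡⟨ expand x (x ^ M) M ⟩
  x * (x ^ M * (x + M)) + x * x ^ M     ≤⟨ +-mono-≤ (*-monoʳ-≤ x (bernoulli x M)) (*-monoʳ-≤ x (^-monoˡ-≤ M (n≤1+n x))) ⟩
  x * (suc x ^ M * x) + x * suc x ^ M   ≡⟨ collect x (suc x ^ M) ⟩
  suc x ^ suc M * x                     ∎
  where
  open ≤-Reasoning
  expand : ∀ x y M → x * y * (x + suc M) ≡ x * (y * (x + M)) + x * y
  expand = solve-∀
  collect : ∀ x z → x * (z * x) + x * z ≡ suc x * z * x
  collect = solve-∀

-- (1 - 1/B)^B ≤ 1/2 for B = x + 1, cleared of denominators.
twice-pred-power : ∀ x → 2 * x ^ suc x ≤ suc x ^ suc x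
twice-pred-power zero = z≤n
twice-pred-power x@(suc _) = begin
  2 * (x * x ^ x)    ≡⟨ x*[y*z]≡y*[x*z] 2 x (x ^ x) ⟩
  x * (2 * x ^ x)    ≤⟨ *-monoʳ-≤ x half ⟩
  x * suc x ^ x      ≤⟨ *-monoˡ-≤ (suc x ^ x) (n≤1+n x) ⟩
  suc x * suc x ^ x  ∎
  where
  open ≤-Reasoning
  double : ∀ x y → x * (2 * y) ≡ y * (x + x)
  double = solve-∀
  half : 2 * x ^ x ≤ suc x ^ x
  half = *-cancelˡ-≤ x (≤-trans (≤-reflexive (double x (x ^ x))) (≤-trans (bernoulli x x) (≤-reflexive (*-comm _ x))))

-- If a fraction at least 1 - (1 - 1/B)^B of the B^B mask choices is good for each of A
-- ID assignments, and each mask choice is good for at most c of them, then A ≤ 2c.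
half-from-average : ∀ B → 0 < B → ∀ A c → (B ^ B ∸ pred B ^ B) * A ≤ B ^ B * c → A ≤ 2 * c
half-from-average B@(suc x) _ A c average = *-cancelˡ-≤ (B ^ B) {{>-nonZero (m^n>0 B B)}} (begin
  B ^ B * A                   ≤⟨ *-monoˡ-≤ A whole≤2good ⟩
  2 * (B ^ B ∸ x ^ B) * A     ≡⟨ *-assoc 2 (B ^ B ∸ x ^ B) A ⟩
  2 * ((B ^ B ∸ x ^ B) * A)   ≤⟨ *-monoʳ-≤ 2 average ⟩
  2 * (B ^ B * c)             ≡⟨ x*[y*z]≡y*[x*z] 2 (B ^ B) c ⟩
  B ^ B * (2 * c)             ∎)
  where
  open ≤-Reasoning
  whole≤2good : B ^ B ≤ 2 * (B ^ B ∸ x ^ B)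
  whole≤2good = begin
    B ^ B                        ≤⟨ m+n≤o⇒m≤o∸n (B ^ B) (+-monoʳ-≤ (B ^ B) (twice-pred-power x)) ⟩
    B ^ B + B ^ B ∸ 2 * x ^ B    ≡⟨ cong (_∸ 2 * x ^ B) (cong (B ^ B +_) (sym (+-identityʳ (B ^ B)))) ⟩
    2 * B ^ B ∸ 2 * x ^ B        ≡⟨ sym (*-distribˡ-∸ 2 (B ^ B) (x ^ B)) ⟩
    2 * (B ^ B ∸ x ^ B)          ∎

-- The theorem with c = 1/3 (in log₂) and ρ = 1/2, for the graphs G_k on n = 4^k vertices.
module Probability (k : ℕ) where
  open Construction k

  -- The event n ≤ 2^(3 · longest path), i.e. longest path ≥ (1/3) log₂ n.
  longEnough : (Fin N → Fin N) → Bool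
  longEnough σ = N ^ 1 ≤ᵇ 2 ^ (3 * longestPath Gk σ)

  longEnough-k : ∀ σ → k ≤ longestPath Gk σ → T (longEnough σ)
  longEnough-k σ k≤L = ≤⇒≤ᵇ (begin
    N ^ 1            ≡⟨ *-identityʳ N ⟩
    2 ^ k * 2 ^ k    ≡⟨ sym (^-distribˡ-+-* 2 k k) ⟩
    2 ^ (k + k)      ≤⟨ ^-monoʳ-≤ 2 (+-mono-≤ k≤L (≤-trans k≤L (m≤m+n L (L + 0)))) ⟩
    2 ^ (3 * L)      ∎)
    where
    open ≤-Reasoning
    L : ℕ
    L = longestPath Gk σ

  maskChoices : List (Fin B → Fin B)
  maskChoices = allFuns B B

  -- For a fixed σ, a mask choice fails only if every copy fails, which happens for at
  -- most (B - 1)^B of the B^B choices; all other choices give a long path.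
  many-good-masks : ∀ σ → σ ∈ idAssignments N →
                    B ^ B ∸ pred B ^ B ≤ count (λ e → longEnough (σ ∘ masked e)) maskChoices
  many-good-masks σ σ∈ = begin
    B ^ B ∸ pred B ^ B                                ≤⟨ ∸-monoʳ-≤ (B ^ B) (count-everywhere B B fails (pred B) few-failing) ⟩
    B ^ B ∸ count (everywhere fails) maskChoices      ≡⟨ cong (_∸ count (everywhere fails) maskChoices) (sym (length-allFuns B B)) ⟩
    length maskChoices ∸ count (everywhere fails) maskChoices
                                                      ≡⟨ sym (count-not (everywhere fails) maskChoices) ⟩
    count (not ∘ everywhere fails) maskChoices        ≤⟨ count-mono _ _ some-copy-climbs maskChoices ⟩
    count (λ e → longEnough (σ ∘ masked e)) maskChoices ∎
    where
    open ≤-Reasoning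
    σ-inj : Injective _≡_ _≡_ σ
    σ-inj = idAssignment-injective σ∈
    fails : Fin B → Fin B → Bool
    fails c m = not (climbs σ c m)
    few-failing : ∀ c → count (fails c) (allFin B) ≤ pred B
    few-failing c with some-mask-climbs σ σ-inj c
    ... | m , m-climbs = subst (λ len → count (fails c) (allFin B) ≤ pred len) (length-tabulate {n = B} id)
      (count-missing (fails c) (allFin B) (lose (∈-allFin m) (λ m-fails → T-not⇒¬T m-fails m-climbs)))
    some-copy-climbs : ∀ e → T (not (everywhere fails e)) → T (longEnough (σ ∘ masked e))
    some-copy-climbs e none-fail with everywhere-violated fails e (T-not⇒¬T none-fail)
    ... | c , c-ok = longEnough-k (σ ∘ masked e) (masked-path σ σ-inj e c (¬T-not⇒T c-ok))

  -- For a fixed mask choice e, σ ↦ σ ∘ masked e is a bijection of the ID assignments.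
  relabelled-good : ∀ e → e ∈ maskChoices →
                    count (λ σ → longEnough (σ ∘ masked e)) (idAssignments N) ≤ count longEnough (idAssignments N)
  relabelled-good e _ = relabel-count (masked e) (masked e) (masked-involutive e) (masked-involutive e) longEnough
    (λ σ τ σ≗τ → cong (λ L → N ^ 1 ≤ᵇ 2 ^ (3 * L)) (longestPath-resp Gk σ τ σ≗τ))

  half-long : 1 * length (idAssignments N) ≤ 2 * count longEnough (idAssignments N)
  half-long = subst (_≤ 2 * count longEnough (idAssignments N)) (sym (*-identityˡ _))
    (half-from-average B (m^n>0 2 k) _ _ (begin
      (B ^ B ∸ pred B ^ B) * length (idAssignments N)
        ≤⟨ averaging (λ e σ → longEnough (σ ∘ masked e)) (idAssignments N) maskChoices _ _ many-good-masks relabelled-good ⟩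
      length maskChoices * count longEnough (idAssignments N)
        ≡⟨ cong (_* count longEnough (idAssignments N)) (length-allFuns B B) ⟩
      B ^ B * count longEnough (idAssignments N) ∎))
    where open ≤-Reasoning

mainTheorem15 : ∃[ p ] ∃[ q ] ∃[ a ] ∃[ b ] (NonZero p × NonZero q × NonZero a × NonZero b ×
                  (∀ (N : ℕ) → ∃[ n ] (N ≤ n × Σ (Graph n) λ G →
                    a * length (idAssignments n)
                      ≤ b * length (filterᵇ (λ σ → n ^ p ≤ᵇ 2 ^ (q * longestPath G σ))
                                            (idAssignments n)))))
mainTheorem15 = 1 , 3 , 1 , 2 , _ , _ , _ , _ , λ n₀ →
  Construction.N n₀ , Construction.k≤N n₀ , Construction.Gk n₀ , Probability.half-long n₀
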